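{- If $\mathring{s}(G)\le\Phi(G)$ for every maximal outerplanar graph $G$, then $\mathring{s}(G)\le\frac73|V(G)|$ for every outerplanar graph $G$.
   Context: The slow-coloring game on a graph $G$: initially all vertices are uncolored. In each round, Lister marks a nonempty set $M$ of uncolored vertices and scores $|M|$; Painter then colors a subset $X\subseteq M$ independent in $G$. The game ends when all vertices are colored; the score is the sum of sizes of marked sets; $\mathring{s}(G)$ is the score under optimal play (Painter minimizing, Lister maximizing). For an outerplanar graph $G$, $\Phi(G)=\sum_{x\in V(G)\cup E(G)}\phi_G(x)$, where $\phi_G(x)=\frac13$ if $x$ is an edge; $\frac53$ if $x$ is a vertex lying in a triangle or of degree at least $3$; $\frac43$ if $x$ is a vertex in no triangle of degree $1$ or $2$; and $1$ if $x$ is an isolated vertex. A maximal outerplanar graph is an outerplanar graph that is not a spanning subgraph of any other outerplanar graph. -}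

module Defs where

open import Data.Nat using (ℕ; zero; suc; _+_; _*_; _≤_)
open import Data.Nat.Base using (_<ᵇ_)
open import Data.Bool using (Bool; true; false; _∧_; if_then_else_)
open import Data.Fin using (Fin; toℕ; _<_)
open import Data.Fin.Subset using (Subset; _∈_; _⊆_; _─_; ∣_∣; Nonempty)
open import Data.Fin.Permutation using (Permutation′; _⟨$⟩ʳ_)
open import Data.List using (List; map)
open import Data.Nat.ListAction using (sum)
open import Data.List.Base using (allFin)
open import Data.Product using (Σ; ∃; _×_)
open import Relation.Binary.PropositionalEquality using (_≡_)
open import Relation.Nullary using (¬_)
import Data.Bool.ListAction as BL

record Graph (n : ℕ) : Set where
  field
    adj     : Fin n → Fin n → Bool
    adj-sym : ∀ u v → adj u v ≡ adj v u
    adj-irr : ∀ v → adj v v ≡ false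
open Graph public

Adj : ∀ {n} → Graph n → Fin n → Fin n → Set
Adj G u v = adj G u v ≡ true

-- A graph is outerplanar iff it can be drawn with its
-- vertices on a circle and its edges as pairwise non-crossing chords.
-- A cyclic placement is given by a permutation π (position of vertex v
-- is π v); chords ab and cd cross iff their endpoints interleave.

Crossing : ∀ {n} → Permutation′ n → Fin n → Fin n → Fin n → Fin n → Set
Crossing π a b c d =
  ((π ⟨$⟩ʳ a) < (π ⟨$⟩ʳ c)) × ((π ⟨$⟩ʳ c) < (π ⟨$⟩ʳ b)) × ((π ⟨$⟩ʳ b) < (π ⟨$⟩ʳ d))

Outerplanar : ∀ {n} → Graph n → Set
Outerplanar {n} G =
  Σ (Permutation′ n) λ π →
    ∀ a b c d → Adj G a b → Adj G c d → ¬ Crossing π a b c d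

SpanningSubgraph : ∀ {n} → Graph n → Graph n → Set
SpanningSubgraph G H = ∀ u v → Adj G u v → Adj H u v

MaximalOuterplanar : ∀ {n} → Graph n → Set
MaximalOuterplanar G =
  Outerplanar G ×
  (∀ H → SpanningSubgraph G H → Outerplanar H → SpanningSubgraph H G)

-- PainterHolds G U k : with U the set of currently uncolored vertices,
-- Painter has a strategy guaranteeing that the total score of the rest
-- of the game is at most k.  (For every nonempty marked set M ⊆ U,
-- |M| ≤ k and Painter can answer with an independent X ⊆ M, after which
-- she can hold the remaining score to k - |M|.)  Painter's X is taken
-- nonempty; an empty answer never helps Painter (the position repeats
-- with extra score), so this does not change the value.

Independent : ∀ {n} → Graph n → Subset n → Set
Independent G X = ∀ u v → u ∈ X → v ∈ X → adj G u v ≡ false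

data PainterHolds {n : ℕ} (G : Graph n) (U : Subset n) (k : ℕ) : Set where
  holds : (∀ (M : Subset n) → M ⊆ U → Nonempty M →
             Σ (Subset n) λ X → X ⊆ M × Nonempty X × Independent G X ×
               Σ ℕ λ r → ∣ M ∣ + r ≡ k × PainterHolds G (U ─ X) r) →
          PainterHolds G U k

V : ∀ n → Subset n
V n = Data.Fin.Subset.⊤

-- s̊(G) ≤ m / 3   (s̊(G) is an integer, so this holds iff there is an
-- integer bound k with 3k ≤ m that Painter can guarantee).
s̊≤⅓ : ∀ {n} → Graph n → ℕ → Set
s̊≤⅓ {n} G m = Σ ℕ λ k → 3 * k ≤ m × PainterHolds G (V n) k

-- The potential Φ, scaled by 3:  3Φ(G) = |E(G)| + Σ_v 3φ(v).

count : ∀ {n} → (Fin n → Bool) → ℕ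
count {n} p = sum (map (λ i → if p i then 1 else 0) (allFin n))

degree : ∀ {n} → Graph n → Fin n → ℕ
degree G v = count (adj G v)

inTriangle : ∀ {n} → Graph n → Fin n → Bool
inTriangle {n} G v =
  BL.or (map (λ u → BL.or (map (λ w → adj G v u ∧ adj G v w ∧ adj G u w) (allFin n))) (allFin n))

edgeCount : ∀ {n} → Graph n → ℕ
edgeCount {n} G = sum (map (λ u → count (λ v → (toℕ u <ᵇ toℕ v) ∧ adj G u v)) (allFin n))

3φ : ∀ {n} → Graph n → Fin n → ℕ
3φ G v with inTriangle G v | degree G v
... | true  | _ = 5
... | false | 0 = 3
... | false | 1 = 4
... | false | 2 = 4
... | false | _ = 5

3Φ : ∀ {n} → Graph n → ℕ
3Φ {n} G = edgeCount G + sum (map (3φ G) (allFin n))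

module Submission where

-- Let G be outerplanar on n vertices.  The proof combines three facts.
--
--  (1) 3Φ(H) ≤ 7n for every outerplanar H: each vertex contributes at most
--      5 and H has at most 2n edges.  For the edge bound, relabel the
--      vertices in circle order (the edge count is invariant, being half
--      the count of ordered adjacent pairs).  A chord ab with a < b is then
--      either the longest chord leaving a (at most one per a), or it is
--      overshot by a chord ac with b < c, in which case non-crossing makes
--      it the only overshot chord ending at b (at most one per b).
--  (2) Deleting edges never raises the score: a Painter strategy on H is a
--      strategy on every spanning subgraph, as independent sets remain
--      independent.
--  (3) G is a spanning subgraph of a maximal outerplanar graph: add each
--      candidate edge whenever the result stays outerplanar, which is
--      decidable since there are finitely many circle placements.

open import Defs
open import Data.Nat using (ℕ; zero; suc; _+_; _*_; _≤_; z≤n)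
open import Data.Nat.Properties
  using (≤-refl; ≤-reflexive; m≤n+m; ≤-trans; +-mono-≤; +-identityʳ; *-identityʳ; *-cancelˡ-≡;
         module ≤-Reasoning)
open import Data.Nat.Tactic.RingSolver using (solve-∀)
open import Data.Nat.ListAction using () renaming (sum to listSum)
open import Data.Bool using (Bool; true; false; _∧_; _∨_; if_then_else_; T)
open import Data.Bool.Properties using (∧-comm; ∨-comm; ∨-zeroʳ; T-≡) renaming (_≟_ to _≟ᵇ_)
open import Data.Fin using (Fin; zero; suc; _<_; _<?_; _≟_)
open import Data.Fin.Properties using (any?; all?; <-cmp; <-irrefl; suc-injective; 0≢1+n)
open import Data.Fin.Permutation using (Permutation′; _⟨$⟩ʳ_; _⟨$⟩ˡ_; inverseʳ; inverseˡ; permutation)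
open import Data.Fin.Subset using (Subset; _⊆_; _─_; ∣_∣; Nonempty)
open import Data.Vec using (Vec; []; _∷_; lookup; tabulate)
open import Data.Vec.Properties using (lookup∘tabulate)
open import Data.List using (List; []; _∷_; map; allFin; cartesianProduct)
open import Data.List.Properties using (map-tabulate)
open import Data.List.Relation.Unary.All using (All; []; _∷_)
import Data.List.Relation.Unary.All as All
open import Data.List.Membership.Propositional.Properties using (∈-allFin; ∈-cartesianProduct⁺)
open import Data.Product using (Σ; ∃; _×_; _,_; proj₁)
open import Data.Sum using (_⊎_; inj₁; inj₂)
open import Data.Empty using (⊥; ⊥-elim)
open import Function using (id; _∘_)
open import Function.Bundles using (Equivalence)
open import Relation.Binary.Definitions using (tri<; tri≈; tri>)
open import Relation.Binary.PropositionalEquality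
  using (_≡_; _≢_; _≗_; refl; sym; trans; cong; cong₂; subst; subst₂; module ≡-Reasoning)
open import Relation.Nullary using (¬_; Dec; yes; no; does; proof; Reflects; invert)
open import Relation.Nullary.Decidable
  using (dec-true; dec-false; _×-dec_; _⊎-dec_; _→-dec_; ¬?; T?; map′)
open import Relation.Unary using (Decidable)
open import Algebra.Properties.CommutativeMonoid.Sum (Data.Nat.Properties.+-0-commutativeMonoid)
  using (sum; sum-syntax; sum-cong-≗; sum-replicate-zero; ∑-distrib-+; ∑-comm; ∑-permute)

listSum-allFin : ∀ n (f : Fin n → ℕ) → listSum (map f (allFin n)) ≡ ∑[ i < n ] f i
listSum-allFin n f = trans (cong listSum (map-tabulate id f)) (listSum-tabulate f)
  where
  listSum-tabulate : ∀ {m} (g : Fin m → ℕ) → listSum (Data.List.tabulate g) ≡ sum g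
  listSum-tabulate {zero}  g = refl
  listSum-tabulate {suc m} g = cong (g zero +_) (listSum-tabulate (g ∘ suc))

∑-bounded : ∀ {n} (f : Fin n → ℕ) c → (∀ i → f i ≤ c) → sum f ≤ n * c
∑-bounded {zero}  f c f≤c = z≤n
∑-bounded {suc n} f c f≤c = +-mono-≤ (f≤c zero) (∑-bounded (f ∘ suc) c (f≤c ∘ suc))

T⇒≡ : ∀ {b} → T b → b ≡ true
T⇒≡ = Equivalence.to T-≡

does⇒witness : ∀ {A : Set} (a? : Dec A) → does a? ≡ true → A
does⇒witness a? eq = invert (subst (Reflects _) eq (proof a?))

ind : Bool → ℕ
ind b = if b then 1 else 0

𝟙 : ∀ {P : Set} → Dec P → ℕ
𝟙 P? = ind (does P?)

𝟙-split : ∀ {P Q : Set} (P? : Dec P) (Q? : Dec Q) → 𝟙 P? ≡ 𝟙 (P? ×-dec ¬? Q?) + 𝟙 (P? ×-dec Q?)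
𝟙-split (yes _) (yes _) = refl
𝟙-split (yes _) (no _)  = refl
𝟙-split (no _)  _       = refl

𝟙-×-yes : ∀ {P Q : Set} (P? : Dec P) (Q? : Dec Q) → P → 𝟙 (P? ×-dec Q?) ≡ 𝟙 Q?
𝟙-×-yes P? Q? p = cong (λ x → ind (x ∧ does Q?)) (dec-true P? p)

𝟙-×-no : ∀ {P Q : Set} (P? : Dec P) (Q? : Dec Q) → ¬ P → 𝟙 (P? ×-dec Q?) ≡ 0
𝟙-×-no P? Q? ¬p = cong (λ x → ind (x ∧ does Q?)) (dec-false P? ¬p)

#-none : ∀ {n} {P : Fin n → Set} (P? : Decidable P) → (∀ i → ¬ P i) → ∑[ i < n ] 𝟙 (P? i) ≡ 0
#-none {n} P? ¬P = trans (sum-cong-≗ none) (sum-replicate-zero n)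
  where
  none : ∀ i → 𝟙 (P? i) ≡ 0
  none i with P? i
  ... | yes p = ⊥-elim (¬P i p)
  ... | no _  = refl

#-atMostOne : ∀ {n} {P : Fin n → Set} (P? : Decidable P) →
              (∀ {x y} → P x → P y → x ≡ y) → ∑[ i < n ] 𝟙 (P? i) ≤ 1
#-atMostOne {zero}  P? unique = z≤n
#-atMostOne {suc n} P? unique with P? zero
... | yes p = ≤-reflexive (cong suc (#-none (P? ∘ suc) (λ i q → 0≢1+n (unique p q))))
... | no _  = #-atMostOne (P? ∘ suc) (λ p q → suc-injective (unique p q))

#arcs : ∀ {n} → (Fin n → Fin n → Bool) → ℕ
#arcs {n} E = ∑[ u < n ] ∑[ v < n ] 𝟙 (T? (E u v))

Chord : ∀ {n} → (Fin n → Fin n → Bool) → Fin n → Fin n → Set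
Chord E a b = a < b × T (E a b)

chord? : ∀ {n} (E : Fin n → Fin n → Bool) a b → Dec (Chord E a b)
chord? E a b = a <? b ×-dec T? (E a b)

#chords : ∀ {n} → (Fin n → Fin n → Bool) → ℕ
#chords {n} E = ∑[ u < n ] ∑[ v < n ] 𝟙 (chord? E u v)

edgeCount≡#chords : ∀ {n} (G : Graph n) → edgeCount G ≡ #chords (adj G)
edgeCount≡#chords {n} G =
  trans (listSum-allFin n (λ u → count (λ v → does (chord? (adj G) u v))))
        (sum-cong-≗ (λ u → listSum-allFin n (λ v → 𝟙 (chord? (adj G) u v))))

arc-split : ∀ {n} (G : Graph n) u v →
            𝟙 (T? (adj G u v)) ≡ 𝟙 (chord? (adj G) u v) + 𝟙 (chord? (adj G) v u)
arc-split G u v with <-cmp u v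
... | tri< u<v _ v≮u = sym (begin
  𝟙 (chord? (adj G) u v) + 𝟙 (chord? (adj G) v u)
    ≡⟨ cong₂ _+_ (𝟙-×-yes (u <? v) (T? (adj G u v)) u<v) (𝟙-×-no (v <? u) (T? (adj G v u)) v≮u) ⟩
  𝟙 (T? (adj G u v)) + 0
    ≡⟨ +-identityʳ _ ⟩
  𝟙 (T? (adj G u v)) ∎)
  where open ≡-Reasoning
... | tri≈ _ refl _ = trans (cong ind (adj-irr G u)) (sym (cong₂ _+_ no-chord no-chord))
  where
  no-chord : 𝟙 (chord? (adj G) u u) ≡ 0
  no-chord = 𝟙-×-no (u <? u) (T? (adj G u u)) (<-irrefl refl)
... | tri> u≮v _ v<u = sym (cong₂ _+_ (𝟙-×-no (u <? v) (T? (adj G u v)) u≮v)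
                                      (trans (𝟙-×-yes (v <? u) (T? (adj G v u)) v<u) (cong ind (adj-sym G v u))))

#arcs≡2#chords : ∀ {n} (G : Graph n) → #arcs (adj G) ≡ #chords (adj G) + #chords (adj G)
#arcs≡2#chords {n} G = begin
  #arcs (adj G)
    ≡⟨ sum-cong-≗ (λ u → trans (sum-cong-≗ (arc-split G u))
                               (∑-distrib-+ (chords-from u) (chords-to u))) ⟩
  ∑[ u < n ] (∑[ v < n ] 𝟙 (chord? (adj G) u v) + ∑[ v < n ] 𝟙 (chord? (adj G) v u))
    ≡⟨ ∑-distrib-+ (sum ∘ chords-from) (sum ∘ chords-to) ⟩
  #chords (adj G) + ∑[ u < n ] ∑[ v < n ] 𝟙 (chord? (adj G) v u)
    ≡⟨ cong (#chords (adj G) +_) (∑-comm (λ u v → 𝟙 (chord? (adj G) v u))) ⟩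
  #chords (adj G) + #chords (adj G) ∎
  where
  open ≡-Reasoning
  chords-from chords-to : Fin n → Fin n → ℕ
  chords-from u v = 𝟙 (chord? (adj G) u v)
  chords-to u v = 𝟙 (chord? (adj G) v u)

relabel : ∀ {n} → Permutation′ n → Graph n → Graph n
relabel π G = record
  { adj     = λ a b → adj G (π ⟨$⟩ˡ a) (π ⟨$⟩ˡ b)
  ; adj-sym = λ a b → adj-sym G (π ⟨$⟩ˡ a) (π ⟨$⟩ˡ b)
  ; adj-irr = λ a → adj-irr G (π ⟨$⟩ˡ a)
  }

#arcs-relabel : ∀ {n} (π : Permutation′ n) (G : Graph n) → #arcs (adj G) ≡ #arcs (adj (relabel π G))
#arcs-relabel {n} π G = begin
  #arcs (adj G)
    ≡⟨ sum-cong-≗ (λ u → ∑-permute (λ v → 𝟙 (T? (adj G u v))) σ) ⟩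
  ∑[ u < n ] ∑[ b < n ] 𝟙 (T? (adj G u (σ ⟨$⟩ʳ b)))
    ≡⟨ ∑-permute (λ u → ∑[ b < n ] 𝟙 (T? (adj G u (σ ⟨$⟩ʳ b)))) σ ⟩
  #arcs (adj (relabel π G)) ∎
  where
  open ≡-Reasoning
  σ : Permutation′ n
  σ = Data.Fin.Permutation.flip π

edgeCount-relabel : ∀ {n} (π : Permutation′ n) (G : Graph n) → edgeCount (relabel π G) ≡ edgeCount G
edgeCount-relabel π G = begin
  edgeCount (relabel π G)     ≡⟨ edgeCount≡#chords (relabel π G) ⟩
  #chords (adj (relabel π G)) ≡⟨ halve (begin
    #chords (adj (relabel π G)) + #chords (adj (relabel π G)) ≡⟨ #arcs≡2#chords (relabel π G) ⟨
    #arcs (adj (relabel π G))                                 ≡⟨ #arcs-relabel π G ⟨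
    #arcs (adj G)                                             ≡⟨ #arcs≡2#chords G ⟩
    #chords (adj G) + #chords (adj G)                         ∎) ⟩
  #chords (adj G)             ≡⟨ edgeCount≡#chords G ⟨
  edgeCount G                 ∎
  where
  open ≡-Reasoning
  halve : ∀ {m k} → m + m ≡ k + k → m ≡ k
  halve {m} {k} eq = *-cancelˡ-≡ m k 2
    (trans (cong (m +_) (+-identityʳ m)) (trans eq (sym (cong (k +_) (+-identityʳ k)))))

-- With 0, 1, …, n-1 placed around a circle in this order, chords ab and cd
-- with a < c < b < d cross.
NonCrossing : ∀ {n} → (Fin n → Fin n → Bool) → Set
NonCrossing {n} E = ∀ {a b c d : Fin n} → a < c → c < b → b < d → T (E a b) → T (E c d) → ⊥

module ChordCount {n} (E : Fin n → Fin n → Bool) (noCross : NonCrossing E) where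

  Overshot : Fin n → Fin n → Set
  Overshot a b = ∃ λ c → b < c × T (E a c)

  overshot? : ∀ a b → Dec (Overshot a b)
  overshot? a b = any? λ c → b <? c ×-dec T? (E a c)

  longest? : ∀ a b → Dec (Chord E a b × ¬ Overshot a b)
  longest? a b = chord? E a b ×-dec ¬? (overshot? a b)

  short? : ∀ a b → Dec (Chord E a b × Overshot a b)
  short? a b = chord? E a b ×-dec overshot? a b

  longest-unique : ∀ a {b b'} → Chord E a b × ¬ Overshot a b → Chord E a b' × ¬ Overshot a b' → b ≡ b'
  longest-unique a {b} {b'} ((_ , ab) , ¬over) ((_ , ab') , ¬over') with <-cmp b b'
  ... | tri< b<b' _ _ = ⊥-elim (¬over (b' , b<b' , ab'))
  ... | tri≈ _ b≡b' _ = b≡b'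
  ... | tri> _ _ b'<b = ⊥-elim (¬over' (b , b'<b , ab))

  -- Two overshot chords ab and a'b with a < a' cannot coexist: the chord a'c
  -- overshooting a'b crosses ab.
  short-crossing : ∀ {a a' b} → a < a' → Chord E a b × Overshot a b → ¬ (Chord E a' b × Overshot a' b)
  short-crossing a<a' ((_ , ab) , _) ((a'<b , _) , c , b<c , a'c) = noCross a<a' a'<b b<c ab a'c

  short-unique : ∀ b {a a'} → Chord E a b × Overshot a b → Chord E a' b × Overshot a' b → a ≡ a'
  short-unique b {a} {a'} short short' with <-cmp a a'
  ... | tri< a<a' _ _ = ⊥-elim (short-crossing a<a' short short')
  ... | tri≈ _ a≡a' _ = a≡a'
  ... | tri> _ _ a'<a = ⊥-elim (short-crossing a'<a short' short)

  #chords≤2n : #chords E ≤ n + n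
  #chords≤2n = begin
    #chords E
      ≡⟨ sum-cong-≗ (λ a → trans (sum-cong-≗ (λ b → 𝟙-split (chord? E a b) (overshot? a b)))
                                 (∑-distrib-+ (#longest a) (#short a))) ⟩
    ∑[ a < n ] (∑[ b < n ] #longest a b + ∑[ b < n ] #short a b)
      ≡⟨ ∑-distrib-+ (sum ∘ #longest) (sum ∘ #short) ⟩
    ∑[ a < n ] ∑[ b < n ] #longest a b + ∑[ a < n ] ∑[ b < n ] #short a b
      ≡⟨ cong (sum (sum ∘ #longest) +_) (∑-comm #short) ⟩
    ∑[ a < n ] ∑[ b < n ] #longest a b + ∑[ b < n ] ∑[ a < n ] #short a b
      ≤⟨ +-mono-≤ (∑-bounded (sum ∘ #longest) 1 (λ a → #-atMostOne (longest? a) (longest-unique a)))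
                  (∑-bounded (λ b → ∑[ a < n ] #short a b) 1
                             (λ b → #-atMostOne (λ a → short? a b) (short-unique b))) ⟩
    n * 1 + n * 1
      ≡⟨ cong₂ _+_ (*-identityʳ n) (*-identityʳ n) ⟩
    n + n ∎
    where
    open ≤-Reasoning
    #longest #short : Fin n → Fin n → ℕ
    #longest a b = 𝟙 (longest? a b)
    #short a b = 𝟙 (short? a b)

relabel-nonCrossing : ∀ {n} (G : Graph n) ((π , _) : Outerplanar G) → NonCrossing (adj (relabel π G))
relabel-nonCrossing G (π , noCross) {a} {b} {c} {d} a<c c<b b<d ab cd =
  noCross (π ⟨$⟩ˡ a) (π ⟨$⟩ˡ b) (π ⟨$⟩ˡ c) (π ⟨$⟩ˡ d) (T⇒≡ ab) (T⇒≡ cd)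
          (atPositions a<c , atPositions c<b , atPositions b<d)
  where
  atPositions : ∀ {x y} → x < y → (π ⟨$⟩ʳ (π ⟨$⟩ˡ x)) < (π ⟨$⟩ʳ (π ⟨$⟩ˡ y))
  atPositions = subst₂ _<_ (sym (inverseʳ π)) (sym (inverseʳ π))

edgeCount-outerplanar : ∀ {n} (G : Graph n) → Outerplanar G → edgeCount G ≤ n + n
edgeCount-outerplanar {n} G op@(π , _) = begin
  edgeCount G                 ≡⟨ edgeCount-relabel π G ⟨
  edgeCount (relabel π G)     ≡⟨ edgeCount≡#chords (relabel π G) ⟩
  #chords (adj (relabel π G)) ≤⟨ ChordCount.#chords≤2n (adj (relabel π G)) (relabel-nonCrossing G op) ⟩
  n + n                       ∎
  where open ≤-Reasoning

3φ≤5 : ∀ {n} (G : Graph n) v → 3φ G v ≤ 5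
3φ≤5 G v with inTriangle G v | degree G v
... | true  | _                 = ≤-refl
... | false | 0                 = m≤n+m 3 2
... | false | 1                 = m≤n+m 4 1
... | false | 2                 = m≤n+m 4 1
... | false | suc (suc (suc _)) = ≤-refl

3Φ-outerplanar : ∀ {n} (G : Graph n) → Outerplanar G → 3Φ G ≤ 7 * n
3Φ-outerplanar {n} G op = begin
  edgeCount G + listSum (map (3φ G) (allFin n))
    ≡⟨ cong (edgeCount G +_) (listSum-allFin n (3φ G)) ⟩
  edgeCount G + ∑[ v < n ] 3φ G v
    ≤⟨ +-mono-≤ (edgeCount-outerplanar G op) (∑-bounded (3φ G) 5 (3φ≤5 G)) ⟩
  n + n + n * 5
    ≡⟨ arithmetic n ⟩
  7 * n ∎
  where
  open ≤-Reasoning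
  arithmetic : ∀ m → m + m + m * 5 ≡ 7 * m
  arithmetic = solve-∀

⊆-refl : ∀ {n} (G : Graph n) → SpanningSubgraph G G
⊆-refl G u v uv = uv

⊆-trans : ∀ {n} {G H K : Graph n} → SpanningSubgraph G H → SpanningSubgraph H K → SpanningSubgraph G K
⊆-trans G⊆H H⊆K u v uv = H⊆K u v (G⊆H u v uv)

outerplanar-⊆ : ∀ {n} {G H : Graph n} → SpanningSubgraph G H → Outerplanar H → Outerplanar G
outerplanar-⊆ G⊆H (π , noCross) = π , λ a b c d ab cd → noCross a b c d (G⊆H a b ab) (G⊆H c d cd)

no-loop : ∀ {n} (G : Graph n) u → ¬ Adj G u u
no-loop G u uu with () ← trans (sym uu) (adj-irr G u)

independent-⊆ : ∀ {n} {G H : Graph n} → SpanningSubgraph G H → ∀ X → Independent H X → Independent G X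
independent-⊆ {G = G} G⊆H X indH u v u∈X v∈X with adj G u v in uv
... | false = refl
... | true with () ← trans (sym (G⊆H u v uv)) (indH u v u∈X v∈X)

painterHolds-⊆ : ∀ {n} {G H : Graph n} {U k} → SpanningSubgraph G H → PainterHolds H U k → PainterHolds G U k
painterHolds-⊆ {G = G} {H} {U} {k} G⊆H (holds strategyH) = holds strategyG
  where
  strategyG : ∀ (M : Subset _) → M ⊆ U → Nonempty M →
              Σ (Subset _) λ X → X ⊆ M × Nonempty X × Independent G X ×
                Σ ℕ λ r → ∣ M ∣ + r ≡ k × PainterHolds G (U ─ X) r
  strategyG M M⊆U M≠∅ with strategyH M M⊆U M≠∅
  ... | X , X⊆M , X≠∅ , indX , r , score , rest =
    X , X⊆M , X≠∅ , independent-⊆ {G = G} {H} G⊆H X indX , r , score , painterHolds-⊆ G⊆H rest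

∃-vec? : ∀ {m} n {P : Vec (Fin m) n → Set} → (∀ v → Dec (P v)) → Dec (∃ P)
∃-vec? zero    P? = map′ ([] ,_) (λ { ([] , p) → p }) (P? [])
∃-vec? (suc n) P? = map′ (λ (x , v , p) → x ∷ v , p) (λ { (x ∷ v , p) → x , v , p })
                         (any? λ x → ∃-vec? n (λ v → P? (x ∷ v)))

lookup-tabulate-inverse : ∀ {n} {f g : Fin n → Fin n} → (∀ x → g (f x) ≡ x) →
                          ∀ x → lookup (tabulate g) (lookup (tabulate f) x) ≡ x
lookup-tabulate-inverse {f = f} {g} g∘f x rewrite lookup∘tabulate f x | lookup∘tabulate g (f x) = g∘f x

module Outerplanarity {n} (G : Graph n) where

  NonCrossingAt : (Fin n → Fin n) → Set
  NonCrossingAt pos = ∀ a b c d → Adj G a b → Adj G c d →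
                      ¬ (pos a < pos c × pos c < pos b × pos b < pos d)

  nonCrossingAt? : ∀ pos → Dec (NonCrossingAt pos)
  nonCrossingAt? pos = all? λ a → all? λ b → all? λ c → all? λ d →
    adj? a b →-dec (adj? c d →-dec ¬? (pos a <? pos c ×-dec (pos c <? pos b ×-dec pos b <? pos d)))
    where
    adj? : ∀ x y → Dec (Adj G x y)
    adj? x y = adj G x y ≟ᵇ true

  nonCrossingAt-≗ : ∀ {pos pos'} → pos ≗ pos' → NonCrossingAt pos → NonCrossingAt pos'
  nonCrossingAt-≗ pos≗pos' noCross a b c d ab cd
    rewrite sym (pos≗pos' a) | sym (pos≗pos' b) | sym (pos≗pos' c) | sym (pos≗pos' d) = noCross a b c d ab cd

  Placement : Vec (Fin n) n → Vec (Fin n) n → Set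
  Placement pos vtx = (∀ x → lookup vtx (lookup pos x) ≡ x) × (∀ y → lookup pos (lookup vtx y) ≡ y)
                    × NonCrossingAt (lookup pos)

  placement? : ∀ pos vtx → Dec (Placement pos vtx)
  placement? pos vtx = all? (λ x → lookup vtx (lookup pos x) ≟ x)
                ×-dec (all? (λ y → lookup pos (lookup vtx y) ≟ y) ×-dec nonCrossingAt? (lookup pos))

  outerplanar? : Dec (Outerplanar G)
  outerplanar? = map′ fromPlacement toPlacement (∃-vec? n λ pos → ∃-vec? n λ vtx → placement? pos vtx)
    where
    fromPlacement : ∃ (λ pos → ∃ (Placement pos)) → Outerplanar G
    fromPlacement (pos , vtx , vtx∘pos , pos∘vtx , noCross) =
      permutation (lookup pos) (lookup vtx) pos∘vtx vtx∘pos , noCross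
    toPlacement : Outerplanar G → ∃ (λ pos → ∃ (Placement pos))
    toPlacement (π , noCross) =
      tabulate (π ⟨$⟩ʳ_) , tabulate (π ⟨$⟩ˡ_) ,
      lookup-tabulate-inverse (λ _ → inverseˡ π) , lookup-tabulate-inverse (λ _ → inverseʳ π) ,
      nonCrossingAt-≗ (λ a → sym (lookup∘tabulate (π ⟨$⟩ʳ_) a)) noCross

open Outerplanarity using (outerplanar?)

SamePair : ∀ {n} → Fin n → Fin n → Fin n → Fin n → Set
SamePair u v x y = (x ≡ u × y ≡ v) ⊎ (x ≡ v × y ≡ u)

samePair? : ∀ {n} (u v x y : Fin n) → Dec (SamePair u v x y)
samePair? u v x y = (x ≟ u ×-dec y ≟ v) ⊎-dec (x ≟ v ×-dec y ≟ u)

samePair?-sym : ∀ {n} (u v x y : Fin n) → does (samePair? u v x y) ≡ does (samePair? u v y x)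
samePair?-sym u v x y = trans (∨-comm (xu ∧ yv) (xv ∧ yu)) (cong₂ _∨_ (∧-comm xv yu) (∧-comm xu yv))
  where
  xu = does (x ≟ u)
  yv = does (y ≟ v)
  xv = does (x ≟ v)
  yu = does (y ≟ u)

addEdge : ∀ {n} (G : Graph n) (u v : Fin n) → u ≢ v → Graph n
addEdge G u v u≢v = record
  { adj     = λ x y → adj G x y ∨ does (samePair? u v x y)
  ; adj-sym = λ x y → cong₂ _∨_ (adj-sym G x y) (samePair?-sym u v x y)
  ; adj-irr = λ x → cong₂ _∨_ (adj-irr G x) (dec-false (samePair? u v x x) (not-uu x))
  }
  where
  not-uu : ∀ x → ¬ SamePair u v x x
  not-uu x (inj₁ (x≡u , x≡v)) = u≢v (trans (sym x≡u) x≡v)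
  not-uu x (inj₂ (x≡v , x≡u)) = u≢v (trans (sym x≡u) x≡v)

module _ {n} (G : Graph n) (u v : Fin n) (u≢v : u ≢ v) where

  addEdge-⊇ : SpanningSubgraph G (addEdge G u v u≢v)
  addEdge-⊇ x y xy = cong (_∨ _) xy

  addEdge-uv : Adj (addEdge G u v u≢v) u v
  addEdge-uv = trans (cong (adj G u v ∨_) (dec-true (samePair? u v u v) (inj₁ (refl , refl))))
                     (∨-zeroʳ (adj G u v))

  addEdge-least : ∀ {H} → SpanningSubgraph G H → Adj H u v → SpanningSubgraph (addEdge G u v u≢v) H
  addEdge-least {H} G⊆H uv x y xy with adj G x y in Gxy
  ... | true  = G⊆H x y Gxy
  ... | false with does⇒witness (samePair? u v x y) xy
  ...   | inj₁ (refl , refl) = uv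
  ...   | inj₂ (refl , refl) = trans (adj-sym H v u) uv

Saturated : ∀ {n} → Graph n → Fin n × Fin n → Set
Saturated {n} H (u , v) = ∀ (H' : Graph n) → SpanningSubgraph H H' → Outerplanar H' → Adj H' u v → Adj H u v

saturated-⊆ : ∀ {n} {H K : Graph n} {p} → SpanningSubgraph H K → Saturated H p → Saturated K p
saturated-⊆ {H = H} {K} {u , v} H⊆K satH H' K⊆H' op' uv =
  H⊆K u v (satH H' (⊆-trans {G = H} {K} {H'} H⊆K K⊆H') op' uv)

saturate : ∀ {n} (G : Graph n) → Outerplanar G → ∀ u v →
           Σ (Graph n) λ H → SpanningSubgraph G H × Outerplanar H × Saturated H (u , v)
saturate G op u v with u ≟ v
... | yes refl = G , ⊆-refl G , op , λ H' _ _ uu → ⊥-elim (no-loop H' u uu)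
... | no u≢v with outerplanar? (addEdge G u v u≢v)
...   | yes op⁺ = addEdge G u v u≢v , addEdge-⊇ G u v u≢v , op⁺ , λ _ _ _ _ → addEdge-uv G u v u≢v
...   | no ¬op⁺ = G , ⊆-refl G , op , λ H' G⊆H' op' uv →
  let G+uv⊆H' = addEdge-least G u v u≢v {H'} G⊆H' uv
  in  ⊥-elim (¬op⁺ (outerplanar-⊆ {G = addEdge G u v u≢v} {H'} G+uv⊆H' op'))

saturateAll : ∀ {n} (ps : List (Fin n × Fin n)) (G : Graph n) → Outerplanar G →
              Σ (Graph n) λ H → SpanningSubgraph G H × Outerplanar H × All (Saturated H) ps
saturateAll []             G op = G , ⊆-refl G , op , []
saturateAll ((u , v) ∷ ps) G op with saturate G op u v
... | H₁ , G⊆H₁ , op₁ , sat₁ with saturateAll ps H₁ op₁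
...   | H , H₁⊆H , opH , sats =
  H , ⊆-trans {G = G} {H₁} {H} G⊆H₁ H₁⊆H , opH , saturated-⊆ {H = H₁} {H} H₁⊆H sat₁ ∷ sats

maximal-extension : ∀ {n} (G : Graph n) → Outerplanar G →
                    Σ (Graph n) λ H → SpanningSubgraph G H × MaximalOuterplanar H
maximal-extension {n} G op with saturateAll (cartesianProduct (allFin n) (allFin n)) G op
... | H , G⊆H , opH , sats = H , G⊆H , opH , λ H' H⊆H' op' u v uv →
  All.lookup sats (∈-cartesianProduct⁺ (∈-allFin u) (∈-allFin v)) H' H⊆H' op' uv

-- Extend G to a maximal outerplanar H; then s̊(G) ≤ s̊(H) ≤ Φ(H) ≤ 7n/3.
lemma24 : (∀ (n : ℕ) (G : Graph n) → MaximalOuterplanar G → s̊≤⅓ G (3Φ G)) →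
          ∀ (n : ℕ) (G : Graph n) → Outerplanar G → s̊≤⅓ G (7 * n)
lemma24 maximalBound n G op with maximal-extension G op
... | H , G⊆H , maxH with maximalBound n H maxH
...   | k , 3k≤3ΦH , painterH =
  k , ≤-trans 3k≤3ΦH (3Φ-outerplanar H (proj₁ maxH)) , painterHolds-⊆ G⊆H painterH
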